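{- Let $q$ be a prime power, let $n$ and $m\ge 3$ be positive integers, and let $I,J$ be nonnegative integers with $I<J<n$; put $K:=J-I$ and, for positive integers $h,\ell$, $C_{h,\ell}:=\frac{q^{h\ell}-1}{q^h-1}$. Let $\alpha_1,\dots,\alpha_m\in\mathbb{F}_{q^n}^*$, $\mathbf{A}=(\alpha_1,\dots,\alpha_m)$, and $$U^{I,J}_{\mathbf{A}}:=\{(x_1,\dots,x_m,f_1(\underline{x}),\dots,f_m(\underline{x})) : x_1,\dots,x_m\in\mathbb{F}_{q^n}\}\subseteq \mathbb{F}_{q^n}^{2m},$$ where $f_i(\underline{x})=x_i^{q^I}+\alpha_{i+1}x_{i+1}^{q^J}$ for $i=1,\dots,m-1$ and $f_m(\underline{x})=x_m^{q^I}+\alpha_1x_1^{q^J}$. Assume $\gcd(I,J)=1$ and that $$K^{I,J}_{\mathbf{A}}:=\frac{\alpha_3\,\alpha_4^{q^K}\,\alpha_5^{q^{2K}}\cdots\alpha_m^{q^{(m-3)K}}\,\alpha_1^{q^{(m-2)K}}}{\alpha_2^{C_{K,m-1}}}$$ is not a $C_{K,m}$-power in $\mathbb{F}_{q^n}$. Then $U^{I,J}_{\mathbf{A}}$ is scattered.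
   Context: An element $a$ of a field $F$ is a $d$-power in $F$ if $a=y^d$ for some $y\in F$. An $\mathbb{F}_q$-subspace $U$ of $\mathbb{F}_{q^n}^k$ is scattered if $\dim_{\mathbb{F}_q}(U\cap\langle v\rangle_{\mathbb{F}_{q^n}})\le 1$ for every $v\in\mathbb{F}_{q^n}^k$. Note $U^{I,J}_{\mathbf{A}}$ is an $\mathbb{F}_q$-subspace of $\mathbb{F}_{q^n}^{2m}$ of $\mathbb{F}_q$-dimension $mn$. -}

module Defs where

open import Level using (Level; _⊔_)
open import Data.Nat as ℕ using (ℕ; zero; suc; _<_)
open import Data.Nat.DivMod using (_%_; m%n<n)
open import Data.Nat.Primality using (Prime)
open import Data.Fin using (Fin; fromℕ<)
import Data.Fin
open import Data.Product using (Σ; ∃; _×_; _,_)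
open import Data.Vec.Functional using (_++_)
open import Function.Bundles using (Bijection)
open import Relation.Nullary using (¬_)
open import Relation.Binary.PropositionalEquality using (_≡_)
import Relation.Binary.PropositionalEquality as P
open import Algebra.Bundles using (CommutativeRing)

IsPrimePower : ℕ → Set
IsPrimePower q = Σ ℕ λ p → Σ ℕ λ k → Prime p × (1 ℕ.≤ k) × (q ≡ p ℕ.^ k)

-- C_{h,l} = (q^{hl} - 1)/(q^h - 1), written as the (equal) geometric sum
-- Σ_{i<l} q^{h i}, which is exact in ℕ.
C : ℕ → ℕ → ℕ → ℕ
C q h zero    = 0
C q h (suc l) = q ℕ.^ (h ℕ.* l) ℕ.+ C q h l

module _ {c ℓ : Level} (F : CommutativeRing c ℓ) where
  open CommutativeRing F

  pow : Carrier → ℕ → Carrier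
  pow x zero    = 1#
  pow x (suc k) = x * pow x k

  -- F is a field with exactly N elements (a model of 𝔽_N), equipped with
  -- the inverse map x ↦ x⁻¹ (its value at 0 is irrelevant)
  record IsFiniteFieldOfOrder (N : ℕ) : Set (c ⊔ ℓ) where
    field
      0≉1   : ¬ (0# ≈ 1#)
      _⁻¹   : Carrier → Carrier
      ⁻¹-inverse : ∀ x → ¬ (x ≈ 0#) → (x * (x ⁻¹)) ≈ 1#
      card  : Bijection setoid (P.setoid (Fin N))

  -- the subfield 𝔽_q = { a : a^q = a } of 𝔽_{q^n}
  InSub : ℕ → Carrier → Set ℓ
  InSub q a = pow a q ≈ a

  IsPower : ℕ → Carrier → Set (c ⊔ ℓ)
  IsPower d a = ∃ λ y → a ≈ pow y d

  InLineMeet : {k : ℕ} → ((Fin k → Carrier) → Set (c ⊔ ℓ)) →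
               (Fin k → Carrier) → (Fin k → Carrier) → Set (c ⊔ ℓ)
  InLineMeet U v w = U w × ∃ λ λ' → ∀ i → w i ≈ (λ' * v i)

  DependentSub : ℕ → {k : ℕ} → (Fin k → Carrier) → (Fin k → Carrier) → Set (c ⊔ ℓ)
  DependentSub q u w = ∃ λ a → ∃ λ b → InSub q a × InSub q b ×
                       ¬ (a ≈ 0# × b ≈ 0#) × (∀ i → ((a * u i) + (b * w i)) ≈ 0#)

  -- U (an 𝔽_q-subspace) is scattered: every U ∩ ⟨v⟩ has 𝔽_q-dimension ≤ 1,
  -- i.e. any two of its vectors are 𝔽_q-linearly dependent
  Scattered : ℕ → {k : ℕ} → ((Fin k → Carrier) → Set (c ⊔ ℓ)) → Set (c ⊔ ℓ)
  Scattered q {k} U = ∀ (v u w : Fin k → Carrier) →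
    InLineMeet U v u → InLineMeet U v w → DependentSub q u w

  -- α_j for j ∈ ℕ, indices taken mod m (0-indexed: α'_j = α_{j+1} of the paper)
  cyc : {m : ℕ} → (Fin m → Carrier) → ℕ → Carrier
  cyc {zero}  A j = 0#
  cyc {suc m} A j = A (fromℕ< (m%n<n j (suc m)))

  fU : (q I J : ℕ) {m : ℕ} → (Fin m → Carrier) → (Fin m → Carrier) → Fin m → Carrier
  fU q I J A x i = pow (x i) (q ℕ.^ I)
                   + (cyc A (suc (Data.Fin.toℕ i)) * pow (cyc x (suc (Data.Fin.toℕ i))) (q ℕ.^ J))

  U-IJ : (q I J : ℕ) {m : ℕ} → (Fin m → Carrier) → (Fin (m ℕ.+ m) → Carrier) → Set (c ⊔ ℓ)
  U-IJ q I J {m} A w = ∃ λ (x : Fin m → Carrier) → ∀ i → w i ≈ (x ++ fU q I J A x) i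

  -- ∏_{t < l} α'_{2+t}^{q^{tK}}  (= α_3 α_4^{q^K} ⋯ α_m^{q^{(m-3)K}} α_1^{q^{(m-2)K}} for l = m-1)
  numProd : (q K : ℕ) {m : ℕ} → (Fin m → Carrier) → ℕ → Carrier
  numProd q K A zero    = 1#
  numProd q K A (suc t) = numProd q K A t * pow (cyc A (2 ℕ.+ t)) (q ℕ.^ (t ℕ.* K))

  KA : (inv : Carrier → Carrier) (q K m : ℕ) → (Fin m → Carrier) → Carrier
  KA inv q K m A = numProd q K A (m ℕ.∸ 1) * inv (pow (cyc A 1) (C q K (m ℕ.∸ 1)))

{-# OPTIONS --safe #-}
-- Let u and w = μ u lie in U, u = (x, f x).  If μ ∈ 𝔽_q the two are dependent (this uses
-- -1 ∈ 𝔽_q: for even q the field has characteristic 2).  Otherwise comparing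
-- f(μ x) = μ f(x) coordinatewise gives, with a = μ^{q^I} - μ and b = μ^{q^J} - μ,
--   a x_j^{q^I} + α_{j+1} b x_{j+1}^{q^J} = 0   (indices mod m).
-- a = b = 0 would put μ in 𝔽_{q^I} ∩ 𝔽_{q^J} = 𝔽_q, and if exactly one of them vanishes
-- then x = 0.  Otherwise y_j = x_j^{q^I} obeys y_j = γ α_{j+1} y_{j+1}^{q^K} with γ = -b/a,
-- and going once around the cycle gives
--   y_2 = γ^{C_{K,m}} α_3 α_4^{q^K} ⋯ α_1^{q^{(m-2)K}} α_2^{q^{(m-1)K}} y_2^{q^{Km}}.
-- As q^{Km} - 1 = (q^K - 1) C_{K,m}, a nonzero y_2 would make K^{I,J}_A a C_{K,m}-th power;
-- so y_2 = 0, which propagates backwards around the cycle, and u = 0.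
module Submission where

open import Defs
open import Level using (Level)
open import Data.Nat as ℕ using (ℕ; zero; suc; _<_; _≤_; _∸_; z≤n; s≤s; NonZero)
import Data.Nat
import Data.Nat.Properties as ℕₚ
open import Data.Nat.Divisibility
  using (_∣_; _∣0; ∣-refl; ∣m∣n⇒∣m+n; ∣m+n∣m⇒∣n; ∣1⇒≡1; ∣m⇒∣m*n; m%n≡0⇒n∣m)
open import Data.Nat.DivMod
  using (_%_; _/_; m%n<n; m≡m%n+[m/n]*n; m<n⇒m%n≡m; [m+n]%n≡m%n; [m+kn]%n≡m%n)
open import Data.Nat.GCD using (gcd; module Bézout; gcd-GCD)
open import Data.Nat.Primality using (prime⇒nonZero)
open import Data.Nat.Tactic.RingSolver using (solve-∀)
open import Data.Fin using (Fin)
import Data.Fin as Fin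
import Data.Fin.Properties as Finₚ
open import Data.List using (List; []; _∷_; length; allFin)
open import Data.List.Properties using (length-tabulate)
open import Data.List.Membership.Propositional using (_∈_; _∉_)
open import Data.List.Membership.Propositional.Properties using (∈-allFin)
open import Data.List.Relation.Unary.Any using (here; there)
import Data.List.Relation.Unary.All as All
open import Data.List.Relation.Unary.AllPairs using ([]; _∷_)
open import Data.List.Relation.Unary.Unique.Propositional using (Unique)
open import Data.List.Relation.Unary.Unique.Propositional.Properties using (allFin⁺)
open import Data.Product using (_,_)
open import Data.Sum using (inj₁; inj₂)
open import Data.Vec.Functional using (_++_)
open import Data.Vec.Functional.Relation.Binary.Pointwise using (Pointwise)
import Data.Vec.Functional.Relation.Binary.Pointwise.Properties as Pointwiseₚ
import Data.Vec.Functional.Relation.Unary.All.Properties as Allₚ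
open import Function using (id)
open import Function.Bundles using (Inverse)
open import Function.Properties.Bijection using (Bijection⇒Inverse)
open import Relation.Nullary using (¬_; Dec; yes; no; contradiction)
open import Relation.Nullary.Decidable using (map′)
open import Relation.Binary.Definitions using (DecidableEquality)
open import Relation.Binary.PropositionalEquality as ≡ using (_≡_; _≢_)
open import Algebra.Bundles using (CommutativeRing)

module Powers {c ℓ} (F : CommutativeRing c ℓ) where
  open CommutativeRing F
  open import Algebra.Properties.CommutativeSemiring.Exp commutativeSemiring
    renaming (_^_ to _^ᶠ_)
  open import Algebra.Properties.Ring ring using (-1*x≈-x; -‿involutive)
  open import Relation.Binary.Reasoning.Setoid setoid

  pow≡^ : ∀ x k → pow F x k ≡ x ^ᶠ k
  pow≡^ x zero    = ≡.refl
  pow≡^ x (suc k) = ≡.cong (x *_) (pow≡^ x k)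

  pow-congˡ : ∀ {x y} k → x ≈ y → pow F x k ≈ pow F y k
  pow-congˡ {x} {y} k x≈y rewrite pow≡^ x k | pow≡^ y k = ^-congˡ k x≈y

  pow-congʳ : ∀ x {k l} → k ≡ l → pow F x k ≈ pow F x l
  pow-congʳ x k≡l = reflexive (≡.cong (pow F x) k≡l)

  pow-homo-* : ∀ x k l → pow F x (k ℕ.+ l) ≈ pow F x k * pow F x l
  pow-homo-* x k l rewrite pow≡^ x (k ℕ.+ l) | pow≡^ x k | pow≡^ x l = ^-homo-* x k l

  pow-assocʳ : ∀ x k l → pow F (pow F x k) l ≈ pow F x (k ℕ.* l)
  pow-assocʳ x k l rewrite pow≡^ (pow F x k) l | pow≡^ x k | pow≡^ x (k ℕ.* l) = ^-assocʳ x k l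

  pow-distrib-* : ∀ x y k → pow F (x * y) k ≈ pow F x k * pow F y k
  pow-distrib-* x y k rewrite pow≡^ (x * y) k | pow≡^ x k | pow≡^ y k = ^-distrib-* x y k

  pow-1# : ∀ k → pow F 1# k ≈ 1#
  pow-1# zero    = refl
  pow-1# (suc k) = trans (*-identityˡ _) (pow-1# k)

  pow-0# : ∀ k .{{_ : NonZero k}} → pow F 0# k ≈ 0#
  pow-0# (suc k) = zeroˡ _

  -1*-1≈1 : - 1# * - 1# ≈ 1#
  -1*-1≈1 = trans (-1*x≈-x (- 1#)) (-‿involutive 1#)

  pow-neg-one-odd : ∀ k → pow F (- 1#) (suc (k ℕ.* 2)) ≈ - 1#
  pow-neg-one-odd zero    = *-identityʳ (- 1#)
  pow-neg-one-odd (suc k) = begin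
    - 1# * (- 1# * pow F (- 1#) (suc (k ℕ.* 2))) ≈⟨ *-assoc _ _ _ ⟨
    (- 1# * - 1#) * pow F (- 1#) (suc (k ℕ.* 2)) ≈⟨ *-cong -1*-1≈1 (pow-neg-one-odd k) ⟩
    1# * - 1#                                    ≈⟨ *-identityˡ _ ⟩
    - 1#                                         ∎

  InSub-^-* : ∀ q I {μ} → InSub F (q ℕ.^ I) μ → ∀ s → InSub F (q ℕ.^ (s ℕ.* I)) μ
  InSub-^-* q I {μ} μ∈ zero    = *-identityʳ μ
  InSub-^-* q I {μ} μ∈ (suc s) = begin
    pow F μ (q ℕ.^ (I ℕ.+ s ℕ.* I))
      ≈⟨ pow-congʳ μ (ℕₚ.^-distribˡ-+-* q I (s ℕ.* I)) ⟩
    pow F μ (q ℕ.^ I ℕ.* q ℕ.^ (s ℕ.* I))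
      ≈⟨ pow-assocʳ μ (q ℕ.^ I) (q ℕ.^ (s ℕ.* I)) ⟨
    pow F (pow F μ (q ℕ.^ I)) (q ℕ.^ (s ℕ.* I))
      ≈⟨ pow-congˡ (q ℕ.^ (s ℕ.* I)) μ∈ ⟩
    pow F μ (q ℕ.^ (s ℕ.* I))
      ≈⟨ InSub-^-* q I μ∈ s ⟩
    μ ∎

  InSub-Bézout : ∀ {q I J μ} x y → suc (y ℕ.* J) ≡ x ℕ.* I →
                 InSub F (q ℕ.^ I) μ → InSub F (q ℕ.^ J) μ → InSub F q μ
  InSub-Bézout {q} {I} {J} {μ} x y 1+yJ≡xI μ∈ᴵ μ∈ᴶ = begin
    pow F μ q                           ≈⟨ pow-congˡ q (InSub-^-* q J μ∈ᴶ y) ⟨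
    pow F (pow F μ (q ℕ.^ (y ℕ.* J))) q ≈⟨ pow-assocʳ μ (q ℕ.^ (y ℕ.* J)) q ⟩
    pow F μ (q ℕ.^ (y ℕ.* J) ℕ.* q)     ≈⟨ pow-congʳ μ qʸᴶq≡qˣᴵ ⟩
    pow F μ (q ℕ.^ (x ℕ.* I))           ≈⟨ InSub-^-* q I μ∈ᴵ x ⟩
    μ                                   ∎
    where
    qʸᴶq≡qˣᴵ : q ℕ.^ (y ℕ.* J) ℕ.* q ≡ q ℕ.^ (x ℕ.* I)
    qʸᴶq≡qˣᴵ = ≡.trans (ℕₚ.*-comm _ q) (≡.cong (q ℕ.^_) 1+yJ≡xI)

  InSub-gcd : ∀ {q I J μ} → gcd I J ≡ 1 →
              InSub F (q ℕ.^ I) μ → InSub F (q ℕ.^ J) μ → InSub F q μ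
  InSub-gcd {I = I} {J} gcd≡1 μ∈ᴵ μ∈ᴶ
    with ≡.subst (λ d → Bézout.Identity d I J) gcd≡1 (Bézout.identity (gcd-GCD I J))
  ... | Bézout.+- x y 1+yJ≡xI = InSub-Bézout x y 1+yJ≡xI μ∈ᴵ μ∈ᴶ
  ... | Bézout.-+ x y 1+xI≡yJ = InSub-Bézout y x 1+xI≡yJ μ∈ᴶ μ∈ᴵ

module ListRemoval {a} {A : Set a} (_≟_ : DecidableEquality A) where

  remove : A → List A → List A
  remove y []       = []
  remove y (x ∷ xs) with x ≟ y
  ... | yes _ = xs
  ... | no  _ = x ∷ remove y xs

  length-remove : ∀ {y xs} → y ∈ xs → length xs ≡ suc (length (remove y xs))
  length-remove {y} {x ∷ xs} y∈ with x ≟ y | y∈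
  ... | yes _   | _          = ≡.refl
  ... | no  x≢y | here y≡x   = contradiction (≡.sym y≡x) x≢y
  ... | no  _   | there y∈xs = ≡.cong suc (length-remove y∈xs)

  ∈-remove⁻ : ∀ {y z} xs → z ∈ remove y xs → z ∈ xs
  ∈-remove⁻ {y} (x ∷ xs) z∈ with x ≟ y | z∈
  ... | yes _ | z∈xs      = there z∈xs
  ... | no  _ | here z≡x  = here z≡x
  ... | no  _ | there z∈′ = there (∈-remove⁻ xs z∈′)

  ∈-remove⁺ : ∀ {y z xs} → z ∈ xs → z ≢ y → z ∈ remove y xs
  ∈-remove⁺ {y} {z} {x ∷ xs} z∈ z≢y with x ≟ y | z∈
  ... | yes x≡y | here z≡x   = contradiction (≡.trans z≡x x≡y) z≢y
  ... | yes _   | there z∈xs = z∈xs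
  ... | no  _   | here z≡x   = here z≡x
  ... | no  _   | there z∈xs = there (∈-remove⁺ z∈xs z≢y)

  ∉-remove : ∀ {y xs} → Unique xs → y ∉ remove y xs
  ∉-remove {y} {x ∷ xs} (x≢xs ∷ uxs) y∈ with x ≟ y | y∈
  ... | yes x≡y | y∈xs       = All.lookup x≢xs y∈xs x≡y
  ... | no  x≢y | here y≡x   = x≢y (≡.sym y≡x)
  ... | no  _   | there y∈xs = ∉-remove uxs y∈xs

  remove⁺ : ∀ {y xs} → Unique xs → Unique (remove y xs)
  remove⁺ {y} {[]}     []            = []
  remove⁺ {y} {x ∷ xs} (x≢xs ∷ uxs) with x ≟ y
  ... | yes _ = uxs
  ... | no  _ = All.tabulate (λ z∈ → All.lookup x≢xs (∈-remove⁻ xs z∈)) ∷ remove⁺ uxs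

module _ {a} {A : Set a} (_≟_ : DecidableEquality A)
         (g : A → A) (g-involutive : ∀ x → g (g x) ≡ x) where
  open ListRemoval _≟_

  involution-fixedPointFree⇒even : ∀ xs → Unique xs →
    (∀ {x} → x ∈ xs → g x ∈ xs) → (∀ {x} → x ∈ xs → g x ≢ x) → 2 ∣ length xs
  involution-fixedPointFree⇒even xs = go (length xs) xs ℕₚ.≤-refl
    where
    -- x and g x leave the list together, so the recursion is on a bound for its length.
    go : ∀ n xs → length xs ≤ n → Unique xs →
         (∀ {x} → x ∈ xs → g x ∈ xs) → (∀ {x} → x ∈ xs → g x ≢ x) → 2 ∣ length xs
    go n       []       _ _ _ _ = 2 ∣0
    go (suc n) (x ∷ xs) (s≤s |xs|≤n) (x≢xs ∷ uxs) closed free =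
      ≡.subst (λ k → 2 ∣ suc k) (≡.sym (length-remove gx∈xs))
        (∣m∣n⇒∣m+n (∣-refl {2}) (go n ys |ys|≤n (remove⁺ uxs) ys-closed ys-free))
      where
      ys : List A
      ys = remove (g x) xs

      gx∈xs : g x ∈ xs
      gx∈xs with closed (here ≡.refl)
      ... | here gx≡x = contradiction gx≡x (free (here ≡.refl))
      ... | there gx∈ = gx∈

      |ys|≤n : length ys ≤ n
      |ys|≤n = ℕₚ.≤-trans (ℕₚ.n≤1+n _)
                 (ℕₚ.≤-trans (ℕₚ.≤-reflexive (≡.sym (length-remove gx∈xs))) |xs|≤n)

      ys-closed : ∀ {z} → z ∈ ys → g z ∈ ys
      ys-closed {z} z∈ys = ∈-remove⁺ gz∈xs gz≢gx
        where
        z∈xs : z ∈ xs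
        z∈xs = ∈-remove⁻ xs z∈ys

        gz≢gx : g z ≢ g x
        gz≢gx gz≡gx = All.lookup x≢xs z∈xs
          (≡.trans (≡.sym (g-involutive x)) (≡.trans (≡.cong g (≡.sym gz≡gx)) (g-involutive z)))

        gz∈xs : g z ∈ xs
        gz∈xs with closed (there z∈xs)
        ... | here gz≡x = contradiction z∈ys
              (≡.subst (_∉ ys) (≡.trans (≡.cong g (≡.sym gz≡x)) (g-involutive z)) (∉-remove uxs))
        ... | there gz∈ = gz∈

      ys-free : ∀ {z} → z ∈ ys → g z ≢ z
      ys-free z∈ys = free (there (∈-remove⁻ xs z∈ys))

module FiniteField {c ℓ} (F : CommutativeRing c ℓ) {N : ℕ} (FF : IsFiniteFieldOfOrder F N) where
  open CommutativeRing F
  open IsFiniteFieldOfOrder FF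
  open Powers F
  open import Algebra.Properties.Ring ring using (-0#≈0#; -‿involutive; +-inverseʳ-unique)
  open import Relation.Binary.Reasoning.Setoid setoid
  open Inverse (Bijection⇒Inverse card)
    using (to; from; to-cong; strictlyInverseˡ; strictlyInverseʳ)

  _≟_ : ∀ x y → Dec (x ≈ y)
  x ≟ y = map′ (λ tx≡ty → begin
                  x           ≈⟨ strictlyInverseʳ x ⟨
                  from (to x) ≡⟨ ≡.cong from tx≡ty ⟩
                  from (to y) ≈⟨ strictlyInverseʳ y ⟩
                  y           ∎)
               to-cong (to x Fin.≟ to y)

  1≉0 : ¬ 1# ≈ 0#
  1≉0 1≈0 = 0≉1 (sym 1≈0)

  ⁻¹-inverseˡ : ∀ x → ¬ x ≈ 0# → x ⁻¹ * x ≈ 1#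
  ⁻¹-inverseˡ x x≉0 = trans (*-comm _ _) (⁻¹-inverse x x≉0)

  *-cancelˡ : ∀ {x y z} → ¬ x ≈ 0# → x * y ≈ x * z → y ≈ z
  *-cancelˡ {x} {y} {z} x≉0 xy≈xz = begin
    y              ≈⟨ *-identityˡ y ⟨
    1# * y         ≈⟨ *-congʳ (⁻¹-inverseˡ x x≉0) ⟨
    (x ⁻¹ * x) * y ≈⟨ *-assoc _ _ _ ⟩
    x ⁻¹ * (x * y) ≈⟨ *-congˡ xy≈xz ⟩
    x ⁻¹ * (x * z) ≈⟨ *-assoc _ _ _ ⟨
    (x ⁻¹ * x) * z ≈⟨ *-congʳ (⁻¹-inverseˡ x x≉0) ⟩
    1# * z         ≈⟨ *-identityˡ z ⟩
    z              ∎

  *≈0⇒≈0 : ∀ {x y} → ¬ x ≈ 0# → x * y ≈ 0# → y ≈ 0#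
  *≈0⇒≈0 {x} x≉0 xy≈0 = *-cancelˡ x≉0 (trans xy≈0 (sym (zeroʳ x)))

  pow≈0⇒≈0 : ∀ {x} k → pow F x k ≈ 0# → x ≈ 0#
  pow≈0⇒≈0     zero    1≈0   = contradiction 1≈0 1≉0
  pow≈0⇒≈0 {x} (suc k) xxᵏ≈0 with x ≟ 0#
  ... | yes x≈0 = x≈0
  ... | no  x≉0 = pow≈0⇒≈0 k (*≈0⇒≈0 x≉0 xxᵏ≈0)

  IsPower-of-unit : ∀ {k z} D → k * pow F z D ≈ 1# → IsPower F D k
  IsPower-of-unit {k} {z} D kzᴰ≈1 with z ≟ 0#
  IsPower-of-unit {k} {z} D kzᴰ≈1 | no z≉0 = z ⁻¹ , (begin
    k                                ≈⟨ *-identityʳ k ⟨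
    k * 1#                           ≈⟨ *-congˡ (pow-1# D) ⟨
    k * pow F 1# D                   ≈⟨ *-congˡ (pow-congˡ D (⁻¹-inverse z z≉0)) ⟨
    k * pow F (z * z ⁻¹) D           ≈⟨ *-congˡ (pow-distrib-* z (z ⁻¹) D) ⟩
    k * (pow F z D * pow F (z ⁻¹) D) ≈⟨ *-assoc _ _ _ ⟨
    (k * pow F z D) * pow F (z ⁻¹) D ≈⟨ *-congʳ kzᴰ≈1 ⟩
    1# * pow F (z ⁻¹) D              ≈⟨ *-identityˡ _ ⟩
    pow F (z ⁻¹) D                   ∎)
  IsPower-of-unit {k} {z} zero    k*1≈1   | yes _   = z , trans (sym (*-identityʳ k)) k*1≈1
  IsPower-of-unit {k} {z} (suc D) kzᴰ⁺¹≈1 | yes z≈0 = contradiction (begin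
    1#                   ≈⟨ kzᴰ⁺¹≈1 ⟨
    k * (z * pow F z D)  ≈⟨ *-congˡ (*-congʳ z≈0) ⟩
    k * (0# * pow F z D) ≈⟨ *-congˡ (zeroˡ _) ⟩
    k * 0#               ≈⟨ zeroʳ k ⟩
    0#                   ∎) 1≉0

  same-line-ratio : ∀ {k} {v u w : Fin k → Carrier} {λ₁ λ₂} → ¬ λ₁ ≈ 0# →
                    (∀ i → u i ≈ λ₁ * v i) → (∀ i → w i ≈ λ₂ * v i) →
                    ∀ i → w i ≈ (λ₂ * λ₁ ⁻¹) * u i
  same-line-ratio {v = v} {u} {w} {λ₁} {λ₂} λ₁≉0 u≈λ₁v w≈λ₂v i = begin
    w i                        ≈⟨ w≈λ₂v i ⟩
    λ₂ * v i                   ≈⟨ *-congˡ (*-identityˡ (v i)) ⟨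
    λ₂ * (1# * v i)            ≈⟨ *-congˡ (*-congʳ (⁻¹-inverseˡ λ₁ λ₁≉0)) ⟨
    λ₂ * ((λ₁ ⁻¹ * λ₁) * v i)  ≈⟨ *-congˡ (*-assoc _ _ _) ⟩
    λ₂ * (λ₁ ⁻¹ * (λ₁ * v i))  ≈⟨ *-assoc _ _ _ ⟨
    (λ₂ * λ₁ ⁻¹) * (λ₁ * v i)  ≈⟨ *-congˡ (u≈λ₁v i) ⟨
    (λ₂ * λ₁ ⁻¹) * u i         ∎

  private
    negate : Fin N → Fin N
    negate i = to (- from i)

    negate-involutive : ∀ i → negate (negate i) ≡ i
    negate-involutive i = ≡.trans
      (to-cong (trans (-‿cong (strictlyInverseʳ _)) (-‿involutive _))) (strictlyInverseˡ i)

    negate-zero : negate (to 0#) ≡ to 0#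
    negate-zero = to-cong (trans (-‿cong (strictlyInverseʳ 0#)) -0#≈0#)

    negate-fixed⇒zero : ¬ 1# + 1# ≈ 0# → ∀ {i} → negate i ≡ i → i ≡ to 0#
    negate-fixed⇒zero 2≉0 {i} negate-i≡i = ≡.trans (≡.sym (strictlyInverseˡ i)) (to-cong t≈0)
      where
      t : Carrier
      t = from i

      -t≈t : - t ≈ t
      -t≈t = trans (sym (strictlyInverseʳ (- t))) (reflexive (≡.cong from negate-i≡i))

      t≈0 : t ≈ 0#
      t≈0 = *≈0⇒≈0 2≉0 (begin
        (1# + 1#) * t   ≈⟨ distribʳ t 1# 1# ⟩
        1# * t + 1# * t ≈⟨ +-cong (*-identityˡ t) (*-identityˡ t) ⟩
        t + t           ≈⟨ +-congˡ -t≈t ⟨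
        t + - t         ≈⟨ -‿inverseʳ t ⟩
        0#              ∎)

  -- If 1 + 1 ≉ 0, negation pairs off the nonzero elements, so N - 1 is even.
  characteristic-two : 2 ∣ N → 1# + 1# ≈ 0#
  characteristic-two 2∣N with (1# + 1#) ≟ 0#
  ... | yes 2≈0 = 2≈0
  ... | no  2≉0 = contradiction (∣1⇒≡1 (∣m+n∣m⇒∣n 2∣|L|+1 2∣|L|)) λ ()
    where
    open ListRemoval Fin._≟_

    L : List (Fin N)
    L = remove (to 0#) (allFin N)

    L-nonzero : ∀ {i} → i ∈ L → i ≢ to 0#
    L-nonzero i∈L i≡0 = ∉-remove (allFin⁺ N) (≡.subst (_∈ L) i≡0 i∈L)

    negate-closed : ∀ {i} → i ∈ L → negate i ∈ L
    negate-closed {i} i∈L = ∈-remove⁺ (∈-allFin _) λ negate-i≡0 → L-nonzero i∈L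
      (≡.trans (≡.sym (negate-involutive i)) (≡.trans (≡.cong negate negate-i≡0) negate-zero))

    2∣|L| : 2 ∣ length L
    2∣|L| = involution-fixedPointFree⇒even Fin._≟_ negate negate-involutive L
      (remove⁺ (allFin⁺ N)) negate-closed
      (λ i∈L negate-i≡i → L-nonzero i∈L (negate-fixed⇒zero 2≉0 negate-i≡i))

    2∣|L|+1 : 2 ∣ length L ℕ.+ 1
    2∣|L|+1 = ≡.subst (2 ∣_) N≡|L|+1 2∣N
      where
      N≡|L|+1 : N ≡ length L ℕ.+ 1
      N≡|L|+1 = ≡.trans (≡.sym (length-tabulate id))
        (≡.trans (length-remove (∈-allFin (to 0#))) (ℕₚ.+-comm 1 (length L)))

  InSub-neg-one : ∀ q → (2 ∣ q → 2 ∣ N) → InSub F q (- 1#)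
  InSub-neg-one q 2∣q⇒2∣N with q % 2 in q%2≡r
  ... | 0 = begin
      pow F (- 1#) q ≈⟨ pow-congˡ q -1≈1 ⟩
      pow F 1# q     ≈⟨ pow-1# q ⟩
      1#             ≈⟨ -1≈1 ⟨
      - 1#           ∎
    where
    -1≈1 : - 1# ≈ 1#
    -1≈1 = sym (+-inverseʳ-unique 1# 1#
                 (characteristic-two (2∣q⇒2∣N (m%n≡0⇒n∣m q 2 q%2≡r))))
  ... | 1 = trans (pow-congʳ (- 1#) q≡odd) (pow-neg-one-odd (q / 2))
    where
    q≡odd : q ≡ suc (q / 2 ℕ.* 2)
    q≡odd = ≡.trans (m≡m%n+[m/n]*n q 2) (≡.cong (ℕ._+ (q / 2 ℕ.* 2)) q%2≡r)
  ... | suc (suc r) = contradiction (≡.subst (ℕ._< 2) q%2≡r (m%n<n q 2)) λ { (s≤s (s≤s ())) }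

module CyclicIndex {c ℓ} (F : CommutativeRing c ℓ) (m′ : ℕ) where
  open CommutativeRing F

  cyc-mod : ∀ (B : Fin (suc m′) → Carrier) j k → j % suc m′ ≡ k % suc m′ →
            cyc F B j ≡ cyc F B k
  cyc-mod B j k j≡k = ≡.cong B (Finₚ.fromℕ<-cong _ _ j≡k (m%n<n j (suc m′)) (m%n<n k (suc m′)))

  cyc-toℕ : ∀ (B : Fin (suc m′) → Carrier) i → cyc F B (Fin.toℕ i) ≡ B i
  cyc-toℕ B i = ≡.cong B (≡.trans
    (Finₚ.fromℕ<-cong _ _ (m<n⇒m%n≡m (Finₚ.toℕ<n i)) (m%n<n (Fin.toℕ i) (suc m′)) (Finₚ.toℕ<n i))
    (Finₚ.fromℕ<-toℕ i (Finₚ.toℕ<n i)))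

  cyc-periodic : ∀ (B : Fin (suc m′) → Carrier) j → cyc F B (j ℕ.+ suc m′) ≡ cyc F B j
  cyc-periodic B j = cyc-mod B (j ℕ.+ suc m′) j ([m+n]%n≡m%n j (suc m′))

  cyc-suc : ∀ (B : Fin (suc m′) → Carrier) j →
            cyc F B (suc (Fin.toℕ (Fin.fromℕ< (m%n<n j (suc m′))))) ≡ cyc F B (suc j)
  cyc-suc B j = cyc-mod B (suc (Fin.toℕ (Fin.fromℕ< (m%n<n j (suc m′))))) (suc j) (begin
    suc (Fin.toℕ (Fin.fromℕ< (m%n<n j (suc m′)))) % suc m′
      ≡⟨ ≡.cong (λ r → suc r % suc m′) (Finₚ.toℕ-fromℕ< _) ⟩
    suc (j % suc m′) % suc m′
      ≡⟨ [m+kn]%n≡m%n (suc (j % suc m′)) (j / suc m′) (suc m′) ⟨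
    (suc (j % suc m′) ℕ.+ j / suc m′ ℕ.* suc m′) % suc m′
      ≡⟨ ≡.cong (λ n → suc n % suc m′) (m≡m%n+[m/n]*n j (suc m′)) ⟨
    suc j % suc m′ ∎)
    where open ≡.≡-Reasoning

  fU-cyc : ∀ q I J A (x : Fin (suc m′) → Carrier) j →
           cyc F (fU F q I J A x) j
             ≡ pow F (cyc F x j) (q ℕ.^ I) + cyc F A (suc j) * pow F (cyc F x (suc j)) (q ℕ.^ J)
  fU-cyc q I J A x j = ≡.cong₂ (λ α y → pow F (cyc F x j) (q ℕ.^ I) + α * pow F y (q ℕ.^ J))
                               (cyc-suc A j) (cyc-suc x j)

^-*-geometric : ∀ q K d → q ℕ.^ K ≡ suc d → ∀ t → q ℕ.^ (K ℕ.* t) ≡ suc (d ℕ.* C q K t)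
^-*-geometric q K d qᴷ≡1+d zero    =
  ≡.trans (≡.cong (q ℕ.^_) (ℕₚ.*-zeroʳ K)) (≡.cong suc (≡.sym (ℕₚ.*-zeroʳ d)))
^-*-geometric q K d qᴷ≡1+d (suc t) = begin
  q ℕ.^ (K ℕ.* suc t)                           ≡⟨ ≡.cong (q ℕ.^_) (ℕₚ.*-suc K t) ⟩
  q ℕ.^ (K ℕ.+ K ℕ.* t)                         ≡⟨ ℕₚ.^-distribˡ-+-* q K (K ℕ.* t) ⟩
  q ℕ.^ K ℕ.* q ℕ.^ (K ℕ.* t)                   ≡⟨ ≡.cong₂ ℕ._*_ qᴷ≡1+d IH ⟩
  suc d ℕ.* suc (d ℕ.* C q K t)                 ≡⟨ distribute d (C q K t) ⟩
  suc (d ℕ.* (suc (d ℕ.* C q K t) ℕ.+ C q K t)) ≡⟨ ≡.cong (λ e → suc (d ℕ.* (e ℕ.+ C q K t))) IH ⟨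
  suc (d ℕ.* (q ℕ.^ (K ℕ.* t) ℕ.+ C q K t))     ∎
  where
  open ≡.≡-Reasoning

  IH : q ℕ.^ (K ℕ.* t) ≡ suc (d ℕ.* C q K t)
  IH = ^-*-geometric q K d qᴷ≡1+d t

  distribute : ∀ d c → suc d ℕ.* suc (d ℕ.* c) ≡ suc (d ℕ.* (suc (d ℕ.* c) ℕ.+ c))
  distribute = solve-∀

module Recurrence {c ℓ} (F : CommutativeRing c ℓ) where
  open CommutativeRing F
  open Powers F
  open import Relation.Binary.Reasoning.Setoid setoid
  open import Algebra.Solver.Ring.NaturalCoefficients.Default commutativeSemiring

  module _ (q K : ℕ) {m} (A : Fin m → Carrier) (γ : Carrier) (Y : ℕ → Carrier)
           (recurrence : ∀ j → Y j ≈ (γ * cyc F A (suc j)) * pow F (Y (suc j)) (q ℕ.^ K)) where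

    unfold : ∀ t → Y 1 ≈ (pow F γ (C q K t) * numProd F q K A t) * pow F (Y (suc t)) (q ℕ.^ (K ℕ.* t))
    unfold zero = begin
      Y 1                                       ≈⟨ *-identityʳ (Y 1) ⟨
      pow F (Y 1) 1                             ≈⟨ pow-congʳ (Y 1) (≡.cong (q ℕ.^_) (ℕₚ.*-zeroʳ K)) ⟨
      pow F (Y 1) (q ℕ.^ (K ℕ.* 0))             ≈⟨ *-identityˡ _ ⟨
      1# * pow F (Y 1) (q ℕ.^ (K ℕ.* 0))        ≈⟨ *-congʳ (*-identityˡ 1#) ⟨
      (1# * 1#) * pow F (Y 1) (q ℕ.^ (K ℕ.* 0)) ∎
    unfold (suc t) = begin
      Y 1
        ≈⟨ unfold t ⟩
      (γᶜ * P) * pow F (Y (suc t)) E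
        ≈⟨ *-congˡ (pow-congˡ E (recurrence (suc t))) ⟩
      (γᶜ * P) * pow F ((γ * α) * pow F Y′ (q ℕ.^ K)) E
        ≈⟨ *-congˡ (trans (pow-distrib-* _ _ E) (*-congʳ (pow-distrib-* γ α E))) ⟩
      (γᶜ * P) * ((γᴱ * pow F α E) * pow F (pow F Y′ (q ℕ.^ K)) E)
        ≈⟨ *-congˡ (*-cong (*-congˡ (pow-congʳ α E≡E′)) Y′-exponent) ⟩
      (γᶜ * P) * ((γᴱ * pow F α E′) * pow F Y′ E₊)
        ≈⟨ solve 5 (λ a b c d e → (a :* b) :* ((c :* d) :* e) := ((c :* a) :* (b :* d)) :* e)
                 refl γᶜ P γᴱ (pow F α E′) (pow F Y′ E₊) ⟩
      ((γᴱ * γᶜ) * (P * pow F α E′)) * pow F Y′ E₊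
        ≈⟨ *-congʳ (*-congʳ (pow-homo-* γ E (C q K t))) ⟨
      (pow F γ (E ℕ.+ C q K t) * (P * pow F α E′)) * pow F Y′ E₊ ∎
      where
      E E′ E₊ : ℕ
      E  = q ℕ.^ (K ℕ.* t)
      E′ = q ℕ.^ (t ℕ.* K)
      E₊ = q ℕ.^ (K ℕ.* suc t)

      γᶜ γᴱ P α Y′ : Carrier
      γᶜ = pow F γ (C q K t)
      γᴱ = pow F γ E
      P  = numProd F q K A t
      α  = cyc F A (suc (suc t))
      Y′ = Y (suc (suc t))

      E≡E′ : E ≡ E′
      E≡E′ = ≡.cong (q ℕ.^_) (ℕₚ.*-comm K t)

      Y′-exponent : pow F (pow F Y′ (q ℕ.^ K)) E ≈ pow F Y′ E₊
      Y′-exponent = trans (pow-assocʳ Y′ (q ℕ.^ K) E) (pow-congʳ Y′ (≡.trans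
        (≡.sym (ℕₚ.^-distribˡ-+-* q K (K ℕ.* t))) (≡.cong (q ℕ.^_) (≡.sym (ℕₚ.*-suc K t)))))

module PeriodicRecurrence {c ℓ} (F : CommutativeRing c ℓ) {N : ℕ} (FF : IsFiniteFieldOfOrder F N) where
  open CommutativeRing F
  open IsFiniteFieldOfOrder FF using (_⁻¹)
  open Powers F
  open FiniteField F FF
  open CyclicIndex F using (cyc-periodic)
  open import Relation.Binary.Reasoning.Setoid setoid
  open import Algebra.Solver.Ring.NaturalCoefficients.Default commutativeSemiring

  module _ (q K : ℕ) .{{_ : NonZero q}} {m′ : ℕ}
           (A : Fin (suc m′) → Carrier) (A≉0 : ∀ i → ¬ A i ≈ 0#) (γ : Carrier) (Y : ℕ → Carrier)
           (recurrence : ∀ j → Y j ≈ (γ * cyc F A (suc j)) * pow F (Y (suc j)) (q ℕ.^ K))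
           (periodic : ∀ j → Y (j ℕ.+ suc m′) ≈ Y j) where

    vanishes-backward : ∀ j → Y (suc j) ≈ 0# → Y j ≈ 0#
    vanishes-backward j Y₁₊ⱼ≈0 = begin
      Y j                                                 ≈⟨ recurrence j ⟩
      (γ * cyc F A (suc j)) * pow F (Y (suc j)) (q ℕ.^ K) ≈⟨ *-congˡ (pow-congˡ (q ℕ.^ K) Y₁₊ⱼ≈0) ⟩
      (γ * cyc F A (suc j)) * pow F 0# (q ℕ.^ K)          ≈⟨ *-congˡ (pow-0# (q ℕ.^ K) {{ℕₚ.m^n≢0 q K}}) ⟩
      (γ * cyc F A (suc j)) * 0#                          ≈⟨ zeroʳ _ ⟩
      0#                                                  ∎

    vanishes-below : ∀ {j k} → j ≤ k → Y k ≈ 0# → Y j ≈ 0#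
    vanishes-below {k = zero}  z≤n   Y₀≈0   = Y₀≈0
    vanishes-below {k = suc k} j≤1+k Y₁₊ₖ≈0 with ℕₚ.m≤n⇒m<n∨m≡n j≤1+k
    ... | inj₁ (s≤s j≤k) = vanishes-below j≤k (vanishes-backward k Y₁₊ₖ≈0)
    ... | inj₂ ≡.refl    = Y₁₊ₖ≈0

    -- The witness is z = γ β W, W = (Y 1)^(q^K - 1): going once around the cycle gives
    -- Y 1 = T · Y 1 · W^D since q^{Km} = 1 + (q^K - 1) C_{K,m}, so T W^D = 1 = K_A z^D.
    nonvanishing⇒IsPower : ¬ Y 1 ≈ 0# → IsPower F (C q K (suc m′)) (KA F _⁻¹ q K (suc m′) A)
    nonvanishing⇒IsPower Y₁≉0 = IsPower-of-unit D (begin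
      (P * B ⁻¹) * pow F ((γ * β) * W) D
        ≈⟨ *-congˡ (trans (pow-distrib-* _ W D) (*-congʳ (pow-distrib-* γ β D))) ⟩
      (P * B ⁻¹) * ((pow F γ D * pow F β D) * Wᴰ)
        ≈⟨ *-congˡ (*-congʳ (*-congˡ βᴰ≈βᴱB)) ⟩
      (P * B ⁻¹) * ((pow F γ D * (pow F β E * B)) * Wᴰ)
        ≈⟨ solve 6 (λ p b⁻¹ g e b w → (p :* b⁻¹) :* ((g :* (e :* b)) :* w)
                                      := (b⁻¹ :* b) :* ((g :* (p :* e)) :* w))
                 refl P (B ⁻¹) (pow F γ D) (pow F β E) B Wᴰ ⟩
      (B ⁻¹ * B) * (T * Wᴰ)
        ≈⟨ *-cong (⁻¹-inverseˡ B B≉0) TWᴰ≈1 ⟩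
      1# * 1#
        ≈⟨ *-identityˡ 1# ⟩
      1# ∎)
      where
      m d D E Q : ℕ
      m = suc m′
      d = ℕ.pred (q ℕ.^ K)
      D = C q K m
      E = q ℕ.^ (m′ ℕ.* K)
      Q = q ℕ.^ (K ℕ.* m)

      P β B W Wᴰ T : Carrier
      P  = numProd F q K A m′
      β  = cyc F A 1
      B  = pow F β (C q K m′)
      W  = pow F (Y 1) d
      Wᴰ = pow F W D
      T  = pow F γ D * (P * pow F β E)

      B≉0 : ¬ B ≈ 0#
      B≉0 B≈0 = A≉0 _ (pow≈0⇒≈0 (C q K m′) B≈0)

      βᴰ≈βᴱB : pow F β D ≈ pow F β E * B
      βᴰ≈βᴱB = trans (pow-homo-* β (q ℕ.^ (K ℕ.* m′)) (C q K m′))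
                     (*-congʳ (pow-congʳ β (≡.cong (q ℕ.^_) (ℕₚ.*-comm K m′))))

      Y₁^Q≈Y₁Wᴰ : pow F (Y 1) Q ≈ Y 1 * Wᴰ
      Y₁^Q≈Y₁Wᴰ = trans (pow-congʳ (Y 1) (^-*-geometric q K d qᴷ≡1+d m))
                        (*-congˡ (sym (pow-assocʳ (Y 1) d D)))
        where
        qᴷ≡1+d : q ℕ.^ K ≡ suc d
        qᴷ≡1+d = ≡.sym (ℕₚ.suc-pred (q ℕ.^ K) {{ℕₚ.m^n≢0 q K}})

      Y₁≈TY₁Wᴰ : Y 1 ≈ T * (Y 1 * Wᴰ)
      Y₁≈TY₁Wᴰ = begin
        Y 1
          ≈⟨ Recurrence.unfold F q K A γ Y recurrence m ⟩
        (pow F γ D * (P * pow F (cyc F A (1 ℕ.+ m)) E)) * pow F (Y (1 ℕ.+ m)) Q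
          ≡⟨ ≡.cong (λ α → (pow F γ D * (P * pow F α E)) * pow F (Y (1 ℕ.+ m)) Q)
                    (cyc-periodic m′ A 1) ⟩
        T * pow F (Y (1 ℕ.+ m)) Q
          ≈⟨ *-congˡ (trans (pow-congˡ Q (periodic 1)) Y₁^Q≈Y₁Wᴰ) ⟩
        T * (Y 1 * Wᴰ) ∎

      TWᴰ≈1 : T * Wᴰ ≈ 1#
      TWᴰ≈1 = *-cancelˡ Y₁≉0 (begin
        Y 1 * (T * Wᴰ) ≈⟨ solve 3 (λ y t w → y :* (t :* w) := t :* (y :* w)) refl (Y 1) T Wᴰ ⟩
        T * (Y 1 * Wᴰ) ≈⟨ Y₁≈TY₁Wᴰ ⟨
        Y 1            ≈⟨ *-identityʳ (Y 1) ⟨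
        Y 1 * 1#       ∎)

    vanishes : ¬ IsPower F (C q K (suc m′)) (KA F _⁻¹ q K (suc m′) A) →
               ∀ {j} → j < suc m′ → Y j ≈ 0#
    vanishes not-power j<m with Y 1 ≟ 0#
    ... | yes Y₁≈0 =
      vanishes-below (ℕₚ.≤-trans (ℕₚ.<⇒≤ j<m) (ℕₚ.n≤1+n _)) (trans (periodic 1) Y₁≈0)
    ... | no  Y₁≉0 = contradiction (nonvanishing⇒IsPower Y₁≉0) not-power

module SemilinearEigenvectors {c ℓ} (F : CommutativeRing c ℓ) {N : ℕ} (FF : IsFiniteFieldOfOrder F N) where
  open CommutativeRing F
  open IsFiniteFieldOfOrder FF using (_⁻¹)
  open import Algebra.Properties.Ring ring
    using (-‿distribˡ-*; -‿distribʳ-*; +-inverseˡ-unique; x∙y⁻¹≈ε⇒x≈y)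
  open Powers F
  open FiniteField F FF
  open CyclicIndex F
  open import Relation.Binary.Reasoning.Setoid setoid
  open import Algebra.Solver.Ring.NaturalCoefficients.Default commutativeSemiring

  module _ (q I J : ℕ) .{{_ : NonZero q}} (I≤J : I ≤ J) (gcd≡1 : gcd I J ≡ 1)
           {m′ : ℕ} (A : Fin (suc m′) → Carrier) (A≉0 : ∀ i → ¬ A i ≈ 0#)
           (not-power : ¬ IsPower F (C q (J ∸ I) (suc m′)) (KA F _⁻¹ q (J ∸ I) (suc m′) A))
           {μ : Carrier} (μ∉𝔽q : ¬ InSub F q μ) (x : Fin (suc m′) → Carrier)
           (eigen : ∀ i → fU F q I J A (λ k → μ * x k) i ≈ μ * fU F q I J A x i) where

    K : ℕ
    K = J ∸ I

    X α Y Z : ℕ → Carrier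
    X = cyc F x
    α = cyc F A
    Y j = pow F (X j) (q ℕ.^ I)
    Z j = pow F (X j) (q ℕ.^ J)

    a b : Carrier
    a = pow F μ (q ℕ.^ I) + - μ
    b = pow F μ (q ℕ.^ J) + - μ

    relation : ∀ j → a * Y j + α (suc j) * (b * Z (suc j)) ≈ 0#
    relation j = begin
      a * Y j + α (suc j) * (b * Z (suc j))
        ≈⟨ solve 6 (λ p₁ p₂ ν y a z → (p₁ :+ ν) :* y :+ a :* ((p₂ :+ ν) :* z)
                                      := (p₁ :* y :+ a :* (p₂ :* z)) :+ ν :* (y :+ a :* z))
                 refl (pow F μ (q ℕ.^ I)) (pow F μ (q ℕ.^ J)) (- μ) (Y j) (α (suc j)) (Z (suc j)) ⟩
      (pow F μ (q ℕ.^ I) * Y j + α (suc j) * (pow F μ (q ℕ.^ J) * Z (suc j))) + - μ * w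
        ≈⟨ +-cong twisted (sym (-‿distribˡ-* μ w)) ⟩
      μ * w + - (μ * w)
        ≈⟨ -‿inverseʳ (μ * w) ⟩
      0# ∎
      where
      w : Carrier
      w = Y j + α (suc j) * Z (suc j)

      twisted : pow F μ (q ℕ.^ I) * Y j + α (suc j) * (pow F μ (q ℕ.^ J) * Z (suc j)) ≈ μ * w
      twisted = begin
        pow F μ (q ℕ.^ I) * Y j + α (suc j) * (pow F μ (q ℕ.^ J) * Z (suc j))
          ≈⟨ +-cong (pow-distrib-* μ (X j) (q ℕ.^ I))
                    (*-congˡ (pow-distrib-* μ (X (suc j)) (q ℕ.^ J))) ⟨
        pow F (μ * X j) (q ℕ.^ I) + α (suc j) * pow F (μ * X (suc j)) (q ℕ.^ J)
          ≡⟨ fU-cyc m′ q I J A (λ k → μ * x k) j ⟨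
        cyc F (fU F q I J A (λ k → μ * x k)) j
          ≈⟨ eigen _ ⟩
        μ * cyc F (fU F q I J A x) j
          ≡⟨ ≡.cong (μ *_) (fU-cyc m′ q I J A x j) ⟩
        μ * w ∎

    Z≈Y^qᴷ : ∀ j → Z j ≈ pow F (Y j) (q ℕ.^ K)
    Z≈Y^qᴷ j = trans (pow-congʳ (X j) qᴶ≡qᴵqᴷ) (sym (pow-assocʳ (X j) (q ℕ.^ I) (q ℕ.^ K)))
      where
      qᴶ≡qᴵqᴷ : q ℕ.^ J ≡ q ℕ.^ I ℕ.* q ℕ.^ K
      qᴶ≡qᴵqᴷ = ≡.trans (≡.cong (q ℕ.^_) (≡.sym (ℕₚ.m+[n∸m]≡n I≤J))) (ℕₚ.^-distribˡ-+-* q I K)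

    recurrence : ¬ a ≈ 0# → ∀ j → Y j ≈ (- (a ⁻¹ * b) * α (suc j)) * pow F (Y (suc j)) (q ℕ.^ K)
    recurrence a≉0 j = begin
      Y j                                      ≈⟨ *-identityˡ (Y j) ⟨
      1# * Y j                                 ≈⟨ *-congʳ (⁻¹-inverseˡ a a≉0) ⟨
      (a ⁻¹ * a) * Y j                         ≈⟨ *-assoc _ _ _ ⟩
      a ⁻¹ * (a * Y j)                         ≈⟨ *-congˡ (+-inverseˡ-unique _ _ (relation j)) ⟩
      a ⁻¹ * - (α (suc j) * (b * Z (suc j)))   ≈⟨ -‿distribʳ-* _ _ ⟨
      - (a ⁻¹ * (α (suc j) * (b * Z (suc j)))) ≈⟨ -‿cong rearrange ⟩
      - ((a ⁻¹ * b) * α (suc j) * Z (suc j))   ≈⟨ -‿distribˡ-* _ _ ⟩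
      - ((a ⁻¹ * b) * α (suc j)) * Z (suc j)   ≈⟨ *-cong (-‿distribˡ-* _ _) (Z≈Y^qᴷ (suc j)) ⟩
      (- (a ⁻¹ * b) * α (suc j)) * pow F (Y (suc j)) (q ℕ.^ K) ∎
      where
      rearrange : a ⁻¹ * (α (suc j) * (b * Z (suc j))) ≈ (a ⁻¹ * b) * α (suc j) * Z (suc j)
      rearrange = solve 4 (λ a⁻¹ α b z → a⁻¹ :* (α :* (b :* z)) := (a⁻¹ :* b) :* α :* z)
                          refl (a ⁻¹) (α (suc j)) b (Z (suc j))

    coordinate-vanishes : ∀ e j {i} → X j ≡ x i → pow F (X j) e ≈ 0# → x i ≈ 0#
    coordinate-vanishes e j Xⱼ≡xᵢ Xⱼᵉ≈0 = trans (reflexive (≡.sym Xⱼ≡xᵢ)) (pow≈0⇒≈0 e Xⱼᵉ≈0)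

    vanishes : ∀ i → x i ≈ 0#
    vanishes i with a ≟ 0# | b ≟ 0#
    ... | yes a≈0 | yes b≈0 =
      contradiction (InSub-gcd {q} {I} {J} gcd≡1 (x∙y⁻¹≈ε⇒x≈y _ _ a≈0) (x∙y⁻¹≈ε⇒x≈y _ _ b≈0))
                    μ∉𝔽q
    ... | no a≉0 | yes b≈0 = coordinate-vanishes (q ℕ.^ I) j (cyc-toℕ m′ x i)
      (*≈0⇒≈0 a≉0 (begin
        a * Y j                               ≈⟨ +-identityʳ _ ⟨
        a * Y j + 0#                          ≈⟨ +-congˡ (trans (*-congˡ b*Z≈0) (zeroʳ _)) ⟨
        a * Y j + α (suc j) * (b * Z (suc j)) ≈⟨ relation j ⟩
        0#                                    ∎))
      where
      j : ℕ
      j = Fin.toℕ i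

      b*Z≈0 : b * Z (suc j) ≈ 0#
      b*Z≈0 = trans (*-congʳ b≈0) (zeroˡ _)
    ... | yes a≈0 | no b≉0 = coordinate-vanishes (q ℕ.^ J) (suc j) Xⱼ₊₁≡xᵢ
      (*≈0⇒≈0 b≉0 (*≈0⇒≈0 (A≉0 _) (begin
        α (suc j) * (b * Z (suc j))           ≈⟨ +-identityˡ _ ⟨
        0# + α (suc j) * (b * Z (suc j))      ≈⟨ +-congʳ (trans (*-congʳ a≈0) (zeroˡ _)) ⟨
        a * Y j + α (suc j) * (b * Z (suc j)) ≈⟨ relation j ⟩
        0#                                    ∎)))
      where
      j : ℕ
      j = Fin.toℕ i ℕ.+ m′

      Xⱼ₊₁≡xᵢ : X (suc j) ≡ x i
      Xⱼ₊₁≡xᵢ = ≡.trans (≡.cong X (≡.sym (ℕₚ.+-suc (Fin.toℕ i) m′)))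
                        (≡.trans (cyc-periodic m′ x (Fin.toℕ i)) (cyc-toℕ m′ x i))
    ... | no a≉0 | no b≉0 = coordinate-vanishes (q ℕ.^ I) (Fin.toℕ i) (cyc-toℕ m′ x i)
      (PeriodicRecurrence.vanishes F FF q K A A≉0 (- (a ⁻¹ * b)) Y (recurrence a≉0) Y-periodic
                                   not-power (Finₚ.toℕ<n i))
      where
      Y-periodic : ∀ j → Y (j ℕ.+ suc m′) ≈ Y j
      Y-periodic j = reflexive (≡.cong (λ v → pow F v (q ℕ.^ I)) (cyc-periodic m′ x j))

module Scattering {c ℓ} (F : CommutativeRing c ℓ) {N : ℕ} (FF : IsFiniteFieldOfOrder F N) where
  open CommutativeRing F
  open IsFiniteFieldOfOrder FF using (_⁻¹)
  open import Algebra.Properties.Ring ring using (-0#≈0#; -‿involutive; -1*x≈-x)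
  open Powers F
  open FiniteField F FF
  open import Relation.Binary.Reasoning.Setoid setoid

  module _ {q : ℕ} .{{_ : NonZero q}} where

    DependentSub-zeroˡ : ∀ {k} {u w : Fin k → Carrier} → (∀ i → u i ≈ 0#) → DependentSub F q u w
    DependentSub-zeroˡ {u = u} {w} u≈0 =
      1# , 0# , pow-1# q , pow-0# q , (λ (1≈0 , _) → 1≉0 1≈0) , λ i → begin
        1# * u i + 0# * w i ≈⟨ +-cong (trans (*-identityˡ (u i)) (u≈0 i)) (zeroˡ (w i)) ⟩
        0# + 0#             ≈⟨ +-identityˡ 0# ⟩
        0#                  ∎

    DependentSub-scalar : ∀ {k} {u w : Fin k → Carrier} {μ} → InSub F q (- 1#) → InSub F q μ →
                          (∀ i → w i ≈ μ * u i) → DependentSub F q u w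
    DependentSub-scalar {u = u} {w} {μ} -1∈𝔽q μ∈𝔽q w≈μu =
      μ , - 1# , μ∈𝔽q , -1∈𝔽q , (λ (_ , -1≈0) → -1≉0 -1≈0) , λ i → begin
        μ * u i + - 1# * w i  ≈⟨ +-congˡ (trans (-1*x≈-x (w i)) (-‿cong (w≈μu i))) ⟩
        μ * u i + - (μ * u i) ≈⟨ -‿inverseʳ (μ * u i) ⟩
        0#                    ∎
      where
      -1≉0 : ¬ - 1# ≈ 0#
      -1≉0 -1≈0 = 1≉0 (trans (sym (-‿involutive 1#)) (trans (-‿cong -1≈0) -0#≈0#))

    fU-cong : ∀ I J {m′} (A : Fin (suc m′) → Carrier) {x y : Fin (suc m′) → Carrier} →
              (∀ i → x i ≈ y i) → ∀ i → fU F q I J A x i ≈ fU F q I J A y i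
    fU-cong I J A x≈y i = +-cong (pow-congˡ (q ℕ.^ I) (x≈y i)) (*-congˡ (pow-congˡ (q ℕ.^ J) (x≈y _)))

    fU-zero : ∀ I J {m′} (A : Fin (suc m′) → Carrier) {x : Fin (suc m′) → Carrier} →
              (∀ i → x i ≈ 0#) → ∀ i → fU F q I J A x i ≈ 0#
    fU-zero I J A x≈0 i =
      trans (+-cong (vanish I (x≈0 i)) (trans (*-congˡ (vanish J (x≈0 _))) (zeroʳ _))) (+-identityˡ 0#)
      where
      vanish : ∀ e {y} → y ≈ 0# → pow F y (q ℕ.^ e) ≈ 0#
      vanish e y≈0 = trans (pow-congˡ (q ℕ.^ e) y≈0) (pow-0# (q ℕ.^ e) {{ℕₚ.m^n≢0 q e}})

    U-eigenvector-vanishes :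
      ∀ {I J m′} (A : Fin (suc m′) → Carrier) → I ≤ J → gcd I J ≡ 1 → (∀ i → ¬ A i ≈ 0#) →
      ¬ IsPower F (C q (J ∸ I) (suc m′)) (KA F _⁻¹ q (J ∸ I) (suc m′) A) →
      ∀ {μ u w} → ¬ InSub F q μ → U-IJ F q I J A u → U-IJ F q I J A w → (∀ i → w i ≈ μ * u i) →
      ∀ i → u i ≈ 0#
    U-eigenvector-vanishes {I} {J} A I≤J gcd≡1 A≉0 not-power {μ} μ∉𝔽q
                           (x , u≈x++fx) (x′ , w≈x′++fx′) w≈μu i =
      trans (u≈x++fx i) (Allₚ.++⁺ (_≈ 0#) x≈0 (fU-zero I J A x≈0) i)
      where
      x′++fx′≈μ[x++fx] : Pointwise (λ s t → s ≈ μ * t) (x′ ++ fU F q I J A x′) (x ++ fU F q I J A x)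
      x′++fx′≈μ[x++fx] i = trans (sym (w≈x′++fx′ i)) (trans (w≈μu i) (*-congˡ (u≈x++fx i)))

      x′≈μx : ∀ k → x′ k ≈ μ * x k
      x′≈μx = Pointwiseₚ.++⁻ˡ (λ s t → s ≈ μ * t) x′ x x′++fx′≈μ[x++fx]

      fx′≈μfx : ∀ k → fU F q I J A x′ k ≈ μ * fU F q I J A x k
      fx′≈μfx = Pointwiseₚ.++⁻ʳ (λ s t → s ≈ μ * t) x′ x x′++fx′≈μ[x++fx]

      x≈0 : ∀ k → x k ≈ 0#
      x≈0 = SemilinearEigenvectors.vanishes F FF q I J I≤J gcd≡1 A A≉0 not-power μ∉𝔽q x
              (λ k → trans (fU-cong I J A (λ l → sym (x′≈μx l)) k) (fx′≈μfx k))

    scattered : ∀ {I J m′} (A : Fin (suc m′) → Carrier) → InSub F q (- 1#) → I ≤ J → gcd I J ≡ 1 →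
                (∀ i → ¬ A i ≈ 0#) →
                ¬ IsPower F (C q (J ∸ I) (suc m′)) (KA F _⁻¹ q (J ∸ I) (suc m′) A) →
                Scattered F q (U-IJ F q I J A)
    scattered A -1∈𝔽q I≤J gcd≡1 A≉0 not-power v u w (u∈U , λ₁ , u≈λ₁v) (w∈U , λ₂ , w≈λ₂v)
      with λ₁ ≟ 0#
    ... | yes λ₁≈0 =
      DependentSub-zeroˡ (λ i → trans (u≈λ₁v i) (trans (*-congʳ λ₁≈0) (zeroˡ (v i))))
    ... | no  λ₁≉0 = eigenvalue-case (same-line-ratio λ₁≉0 u≈λ₁v w≈λ₂v)
      where
      eigenvalue-case : ∀ {μ} → (∀ i → w i ≈ μ * u i) → DependentSub F q u w
      eigenvalue-case {μ} w≈μu with pow F μ q ≟ μ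
      ... | yes μ∈𝔽q = DependentSub-scalar -1∈𝔽q μ∈𝔽q w≈μu
      ... | no  μ∉𝔽q =
        DependentSub-zeroˡ (U-eigenvector-vanishes A I≤J gcd≡1 A≉0 not-power μ∉𝔽q u∈U w∈U w≈μu)

theorem2p4 : ∀ {c ℓ : Level} (q n m I J : ℕ) → IsPrimePower q → 1 ≤ n → 3 ≤ m →
    I < J → J < n → gcd I J ≡ 1 →
    (F : CommutativeRing c ℓ) → (FF : IsFiniteFieldOfOrder F (q Data.Nat.^ n)) →
    (A : Fin m → CommutativeRing.Carrier F) →
    (∀ i → ¬ (CommutativeRing._≈_ F (A i) (CommutativeRing.0# F))) →
    ¬ IsPower F (C q (J ∸ I) m) (KA F (IsFiniteFieldOfOrder._⁻¹ FF) q (J ∸ I) m A) →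
    Scattered F q (U-IJ F q I J A)
theorem2p4 .(p ℕ.^ k) (suc n′) (suc m′) I J (p , k , p-prime , _ , ≡.refl) _ (s≤s _) I<J _ gcd≡1
           F FF A A≉0 not-power =
  Scattering.scattered F FF {{q≢0}} A -1∈𝔽q (ℕₚ.<⇒≤ I<J) gcd≡1 A≉0 not-power
  where
  q : ℕ
  q = p ℕ.^ k

  q≢0 : NonZero q
  q≢0 = ℕₚ.m^n≢0 p k {{prime⇒nonZero p-prime}}

  -1∈𝔽q : InSub F q (CommutativeRing.-_ F (CommutativeRing.1# F))
  -1∈𝔽q = FiniteField.InSub-neg-one F FF q (∣m⇒∣m*n (q ℕ.^ n′))
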